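{- Let $k\ge 4$. For bin packing with cardinality constraint $k$, every online algorithm has absolute competitive ratio at least $2$.
   Context: Bin packing with cardinality constraints (BPCC): there is a global integer parameter $k\ge 2$; the input is a sequence of items $1,\dots,n$ with sizes $s_i\in(0,1]$. Items must be partitioned into bins so that each bin has total size (level) at most $1$ and contains at most $k$ items; the goal is to minimize the number of bins. An online algorithm receives items one by one and must irrevocably assign each item to a bin (an existing one or a new one) before seeing the next item. For an algorithm $A$ and input $L$, $A(L)$ is the number of bins it uses and $OPT(L)$ is the minimum possible number of bins. The absolute competitive ratio of $A$ is $\sup_L A(L)/OPT(L)$. -}

module Defs where

open import Data.Nat as ℕ using (ℕ; zero; suc)
import Data.Nat.Properties as ℕP
open import Data.Integer using (+_)
open import Data.Rational using (ℚ; 0ℚ; 1ℚ; _+_; _≤_; _<_; _/_)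
open import Data.Rational.Properties using (_≤?_)
open import Data.List using (List; []; _∷_; _++_; [_]; length; foldr; map; filter; lookup; allFin)
open import Data.Fin as Fin using (Fin)
open import Data.Product using (Σ; _×_)
open import Relation.Nullary using (yes; no)

ℕtoℚ : ℕ → ℚ
ℕtoℚ n = + n / 1

ValidSize : ℚ → Set
ValidSize s = (0ℚ < s) × (s ≤ 1ℚ)

level : List ℚ → ℚ
level = foldr _+_ 0ℚ

-- a state of an online packing: the list of bins opened so far (in order of opening),
-- each bin being the list of sizes of the items it contains
Bins : Set
Bins = List (List ℚ)

-- A deterministic online algorithm: given the sizes of all items seen so far (in arrival
-- order) and the size of the current item, it names the index of the bin (0-based, in order
-- of opening) into which the current item is put.  An index that is not an existing bin
-- into which the item may legally go (cardinality < k and level + s ≤ 1) means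
-- "open a new bin".
OnlineAlg : Set
OnlineAlg = List ℚ → ℚ → ℕ

fitsB : ℕ → List ℚ → ℚ → Set
fitsB k b s = (length b ℕ.< k) × (level b + s ≤ 1ℚ)

place : ℕ → ℕ → ℚ → Bins → Bins
place k i s [] = [ s ∷ [] ]
place k zero s (b ∷ bs) with length b ℕ.<? k | level b + s ≤? 1ℚ
... | yes _ | yes _ = (s ∷ b) ∷ bs
... | yes _ | no _  = b ∷ (bs ++ [ s ∷ [] ])
... | no _  | _     = b ∷ (bs ++ [ s ∷ [] ])
place k (suc i) s (b ∷ bs) = b ∷ place k i s bs

runFrom : ℕ → OnlineAlg → List ℚ → Bins → List ℚ → Bins
runFrom k A hist bins [] = bins
runFrom k A hist bins (s ∷ rest) =
  runFrom k A (hist ++ [ s ]) (place k (A hist s) s bins) rest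

cost : ℕ → OnlineAlg → List ℚ → ℕ
cost k A L = length (runFrom k A [] [] L)

binContents : {m : ℕ} (L : List ℚ) → (Fin (length L) → Fin m) → Fin m → List ℚ
binContents L f j = map (lookup L) (filter (λ i → f i Fin.≟ j) (allFin (length L)))

Packing : ℕ → List ℚ → ℕ → Set
Packing k L m =
  Σ (Fin (length L) → Fin m) λ f →
    (j : Fin m) → (level (binContents L f j) ≤ 1ℚ) × (length (binContents L f j) ℕ.≤ k)

module Submission where

-- Fix c < 2 and an online algorithm A.  The adversary first releases up to k
-- "grains", tiny items whose total size is at most 1/24.  If A ever opens a
-- second bin after j ≤ k grains, the input stops there: A uses 2 bins where
-- 1 suffices.  Otherwise all k grains share one bin, which is now closed by the
-- cardinality constraint.  Next come items 1/8 and 1/4; 1/8 opens a second bin.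
--   * If 1/4 opens a third bin, a final item 11/12 forces a fourth one.
--   * If 1/4 joins 1/8, two items 2/3 force a third and a fourth bin.
-- In both cases two bins suffice offline: {grain, grain, big items of one
-- group} and {k − 2 grains, the remaining two items}.  So A uses 2·OPT bins.

open import Defs
open import Data.Nat using (ℕ; _≤_)
open import Data.Integer using (+_)
open import Data.Rational using (ℚ; _*_; _<_; _/_)
open import Data.List using (List)
open import Data.List.Relation.Unary.All using (All)
open import Data.Product using (Σ; _×_)

open import Data.Nat using (zero; suc; z≤n; s≤s)
import Data.Nat as ℕ
import Data.Nat.Properties as ℕP
open import Data.Rational using (0ℚ; 1ℚ; 1/_; _+_)
import Data.Rational as ℚ
import Data.Rational.Properties as ℚP
open import Data.List using ([]; _∷_; _++_; [_]; length; replicate; map; filter; tabulate; lookup)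
import Data.List.Properties as LP
open import Data.List.Relation.Unary.All using ([]; _∷_)
open import Data.List.Relation.Unary.All.Properties using (++⁺; replicate⁺)
open import Data.Fin as Fin using (Fin; toℕ)
open import Data.Product using (_,_)
open import Data.Sum using (_⊎_; inj₁; inj₂; [_,_]′)
open import Data.Empty using (⊥; ⊥-elim)
open import Data.Unit using (tt)
open import Function using (_∘_)
open import Relation.Nullary using (yes; no; ¬_)
open import Relation.Nullary.Decidable using (True; False; toWitness; toWitnessFalse)
open import Relation.Binary.PropositionalEquality
  using (_≡_; refl; sym; trans; cong; subst; module ≡-Reasoning)

level-++ : (xs ys : List ℚ) → level (xs ++ ys) ≡ level xs + level ys
level-++ []       ys = sym (ℚP.+-identityˡ (level ys))
level-++ (x ∷ xs) ys = trans (cong (x ℚ.+_) (level-++ xs ys)) (sym (ℚP.+-assoc x (level xs) (level ys)))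

level-replicate : (n : ℕ) (x : ℚ) → level (replicate n x) ≡ level (replicate n 1ℚ) * x
level-replicate zero    x = sym (ℚP.*-zeroˡ x)
level-replicate (suc n) x = begin
  x + level (replicate n x)                  ≡⟨ cong (x ℚ.+_) (level-replicate n x) ⟩
  x + level (replicate n 1ℚ) * x             ≡⟨ cong (ℚ._+ level (replicate n 1ℚ) * x) (sym (ℚP.*-identityˡ x)) ⟩
  1ℚ * x + level (replicate n 1ℚ) * x        ≡⟨ sym (ℚP.*-distribʳ-+ x 1ℚ (level (replicate n 1ℚ))) ⟩
  (1ℚ + level (replicate n 1ℚ)) * x          ∎
  where open ≡-Reasoning

level-replicate-mono : ∀ {m n} (x : ℚ) → 0ℚ ℚ.≤ x → m ≤ n →
  level (replicate m x) ℚ.≤ level (replicate n x)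
level-replicate-mono {n = zero}  x 0≤x z≤n = ℚP.≤-refl
level-replicate-mono {n = suc n} x 0≤x z≤n =
  ℚP.+-mono-≤ 0≤x (level-replicate-mono {n = n} x 0≤x z≤n)
level-replicate-mono x 0≤x (s≤s m≤n) = ℚP.+-monoʳ-≤ x (level-replicate-mono x 0≤x m≤n)

-- Grains: suc k′ of them have total size exactly 1/24.

1/24 : ℚ
1/24 = + 1 / 24

-- The rational number suc k′ (as a level, so that 'level-replicate' applies).
multiplicity : ℕ → ℚ
multiplicity k′ = level (replicate (suc k′) 1ℚ)

multiplicity-pos : (k′ : ℕ) → 0ℚ < multiplicity k′
multiplicity-pos k′ = ℚP.+-mono-<-≤ (toWitness {a? = 0ℚ ℚP.<? 1ℚ} tt)
  (level-replicate-mono {n = k′} 1ℚ (toWitness {a? = 0ℚ ℚP.≤? 1ℚ} tt) z≤n)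

multiplicity-positive : (k′ : ℕ) → ℚ.Positive (multiplicity k′)
multiplicity-positive k′ = ℚ.positive (multiplicity-pos k′)

multiplicity-nonZero : (k′ : ℕ) → ℚ.NonZero (multiplicity k′)
multiplicity-nonZero k′ = ℚP.pos⇒nonZero (multiplicity k′) {{multiplicity-positive k′}}

reciprocal : ℕ → ℚ
reciprocal k′ = (1/ multiplicity k′) {{multiplicity-nonZero k′}}

grain : ℕ → ℚ
grain k′ = reciprocal k′ * 1/24

grain-pos : (k′ : ℕ) → 0ℚ < grain k′
grain-pos k′ = ℚP.positive⁻¹ (grain k′)
  {{ℚP.pos*pos⇒pos (reciprocal k′) {{ℚP.1/pos⇒pos (multiplicity k′) {{multiplicity-positive k′}}}} 1/24}}

all-grains : (k′ : ℕ) → level (replicate (suc k′) (grain k′)) ≡ 1/24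
all-grains k′ = begin
  level (replicate (suc k′) (grain k′))       ≡⟨ level-replicate (suc k′) (grain k′) ⟩
  multiplicity k′ * (reciprocal k′ * 1/24)     ≡⟨ sym (ℚP.*-assoc (multiplicity k′) _ 1/24) ⟩
  multiplicity k′ * reciprocal k′ * 1/24       ≡⟨ cong (_* 1/24) (ℚP.*-inverseʳ (multiplicity k′) {{multiplicity-nonZero k′}}) ⟩
  1ℚ * 1/24                                   ≡⟨ ℚP.*-identityˡ 1/24 ⟩
  1/24                                        ∎
  where open ≡-Reasoning

grains-level : (k′ n : ℕ) → n ≤ suc k′ → level (replicate n (grain k′)) ℚ.≤ 1/24
grains-level k′ n n≤k = ℚP.≤-trans
  (level-replicate-mono (grain k′) (ℚP.<⇒≤ (grain-pos k′)) n≤k)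
  (ℚP.≤-reflexive (all-grains k′))

grain-valid : (k′ : ℕ) → ValidSize (grain k′)
grain-valid k′ = grain-pos k′ , ℚP.≤-trans
  (subst (ℚ._≤ 1/24) (ℚP.+-identityʳ (grain k′)) (grains-level k′ 1 (s≤s z≤n)))
  (toWitness {a? = 1/24 ℚP.≤? 1ℚ} tt)

Rejects : ℕ → ℚ → List ℚ → Set
Rejects k s b = length b ℕ.< k → level b + s ℚ.≤ 1ℚ → ⊥

full-rejects : ∀ {k} s b → length b ≡ k → Rejects k s b
full-rejects s b len≡k len<k _ = ℕP.<-irrefl len≡k len<k

overfull-rejects : ∀ {k} s b → False (level b + s ℚP.≤? 1ℚ) → Rejects k s b
overfull-rejects s b no-room _ = toWitnessFalse no-room

place-rejected : ∀ k i s bins → All (Rejects k s) bins → place k i s bins ≡ bins ++ [ [ s ] ]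
place-rejected k i       s []         _          = refl
place-rejected k zero    s (b ∷ bins) (rej ∷ _) with length b ℕ.<? k | level b + s ℚP.≤? 1ℚ
... | yes fits | yes room = ⊥-elim (rej fits room)
... | yes _    | no _     = refl
... | no _     | _        = refl
place-rejected k (suc i) s (b ∷ bins) (_ ∷ rejs) = cong (b ∷_) (place-rejected k i s bins rejs)

runFrom-++ : ∀ k A hist bins xs ys →
  runFrom k A hist bins (xs ++ ys) ≡ runFrom k A (hist ++ xs) (runFrom k A hist bins xs) ys
runFrom-++ k A hist bins []       ys = cong (λ h → runFrom k A h bins ys) (sym (LP.++-identityʳ hist))
runFrom-++ k A hist bins (x ∷ xs) ys = trans
  (runFrom-++ k A (hist ++ [ x ]) (place k (A hist x) x bins) xs ys)
  (cong (λ h → runFrom k A h (runFrom k A (hist ++ [ x ]) (place k (A hist x) x bins) xs) ys)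
        (LP.++-assoc hist [ x ] xs))

runFrom-snoc : ∀ k A xs x →
  runFrom k A [] [] (xs ++ [ x ]) ≡ place k (A xs x) x (runFrom k A [] [] xs)
runFrom-snoc k A xs x = runFrom-++ k A [] [] xs [ x ]

replicate-snoc : ∀ n (x : ℚ) → replicate (suc n) x ≡ replicate n x ++ [ x ]
replicate-snoc zero    x = refl
replicate-snoc (suc n) x = cong (x ∷_) (replicate-snoc n x)

place-single : ∀ k i s b → (place k i s [ b ] ≡ [ s ∷ b ]) ⊎ (length (place k i s [ b ]) ≡ 2)
place-single k zero    s b with length b ℕ.<? k | level b + s ℚP.≤? 1ℚ
... | yes _ | yes _ = inj₁ refl
... | yes _ | no _  = inj₂ refl
... | no _  | _     = inj₂ refl
place-single k (suc i) s b = inj₂ refl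

-- Phase 1: equal items, until a second bin is opened.

OpensSecondBin : ℕ → OnlineAlg → ℚ → ℕ → Set
OpensSecondBin k A s n = Σ ℕ λ j → (j ≤ n) × (cost k A (replicate j s) ≡ 2)

runFrom-replicate-suc : ∀ k A s n → runFrom k A [] [] (replicate (suc n) s)
  ≡ place k (A (replicate n s) s) s (runFrom k A [] [] (replicate n s))
runFrom-replicate-suc k A s n =
  trans (cong (runFrom k A [] []) (replicate-snoc n s)) (runFrom-snoc k A (replicate n s) s)

equal-items-phase : ∀ k A s n →
  OpensSecondBin k A s (suc n) ⊎ (runFrom k A [] [] (replicate (suc n) s) ≡ [ replicate (suc n) s ])
equal-items-phase k A s zero = inj₂ refl
equal-items-phase k A s (suc n) with equal-items-phase k A s n
... | inj₁ (j , j≤n , two) = inj₁ (j , ℕP.m≤n⇒m≤1+n j≤n , two)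
... | inj₂ one-bin with place-single k (A (replicate (suc n) s) s) s (replicate (suc n) s)
...   | inj₁ joins = inj₂ (trans (trans (runFrom-replicate-suc k A s (suc n)) (cong (place k _ s) one-bin)) joins)
...   | inj₂ opens = inj₁ (suc (suc n) , ℕP.≤-refl ,
          trans (cong length (trans (runFrom-replicate-suc k A s (suc n)) (cong (place k _ s) one-bin))) opens)

-- Phase 2: after a full bin, items 1/8, 1/4 and then 11/12 or 2/3, 2/3.

1/8 1/4 11/12 2/3 : ℚ
1/8   = + 1 / 8
1/4   = + 1 / 4
11/12 = + 11 / 12
2/3   = + 2 / 3

tailX tailY : List ℚ
tailX = 1/8 ∷ 1/4 ∷ 11/12 ∷ []
tailY = 1/8 ∷ 1/4 ∷ 2/3 ∷ 2/3 ∷ []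

module AfterFullBin (k : ℕ) (A : OnlineAlg) (b : List ℚ) (full : length b ≡ k) where

  quarter-placement : ∀ i →
    (place k i 1/4 (b ∷ [ 1/8 ] ∷ []) ≡ b ∷ [ 1/8 ] ∷ [ 1/4 ] ∷ []) ⊎
    (place k i 1/4 (b ∷ [ 1/8 ] ∷ []) ≡ b ∷ (1/4 ∷ 1/8 ∷ []) ∷ [])
  quarter-placement zero with length b ℕ.<? k | level b + 1/4 ℚP.≤? 1ℚ
  ... | yes fits | yes room = ⊥-elim (full-rejects 1/4 b full fits room)
  ... | yes _    | no _     = inj₁ refl
  ... | no _     | _        = inj₁ refl
  quarter-placement (suc zero) with 1 ℕ.<? k | level [ 1/8 ] + 1/4 ℚP.≤? 1ℚ
  ... | yes _ | yes _ = inj₂ refl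
  ... | yes _ | no _  = inj₁ refl
  ... | no _  | _     = inj₁ refl
  quarter-placement (suc (suc i)) = inj₁ refl

  eighth-opens : ∀ i → place k i 1/8 [ b ] ≡ b ∷ [ 1/8 ] ∷ []
  eighth-opens i = place-rejected k i 1/8 [ b ] (full-rejects 1/8 b full ∷ [])

  finish-X : ∀ hist → length (runFrom k A hist (b ∷ [ 1/8 ] ∷ [ 1/4 ] ∷ []) [ 11/12 ]) ≡ 4
  finish-X hist = cong length (place-rejected k (A hist 11/12) 11/12 (b ∷ [ 1/8 ] ∷ [ 1/4 ] ∷ [])
    (full-rejects 11/12 b full ∷ overfull-rejects 11/12 [ 1/8 ] tt ∷ overfull-rejects 11/12 [ 1/4 ] tt ∷ []))

  finish-Y : ∀ hist → length (runFrom k A hist (b ∷ (1/4 ∷ 1/8 ∷ []) ∷ []) (2/3 ∷ 2/3 ∷ [])) ≡ 4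
  finish-Y hist = cong length (begin
    place k i₂ 2/3 (place k i₁ 2/3 (b ∷ small ∷ []))
      ≡⟨ cong (place k i₂ 2/3) (place-rejected k i₁ 2/3 (b ∷ small ∷ []) (b-rejects ∷ 2/3-misses small ∷ [])) ⟩
    place k i₂ 2/3 (b ∷ small ∷ [ 2/3 ] ∷ [])
      ≡⟨ place-rejected k i₂ 2/3 (b ∷ small ∷ [ 2/3 ] ∷ []) (b-rejects ∷ 2/3-misses small ∷ 2/3-misses [ 2/3 ] ∷ []) ⟩
    b ∷ small ∷ [ 2/3 ] ∷ [ 2/3 ] ∷ []
      ∎)
    where
    open ≡-Reasoning
    i₁ i₂ : ℕ
    i₁ = A hist 2/3
    i₂ = A (hist ++ [ 2/3 ]) 2/3
    small : List ℚ
    small = 1/4 ∷ 1/8 ∷ []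
    2/3-misses : ∀ c → {False (level c + 2/3 ℚP.≤? 1ℚ)} → Rejects k 2/3 c
    2/3-misses c {no-room} = overfull-rejects 2/3 c no-room
    b-rejects : Rejects k 2/3 b
    b-rejects = full-rejects 2/3 b full

  forces-four-bins : ∀ hist → (length (runFrom k A hist [ b ] tailX) ≡ 4) ⊎ (length (runFrom k A hist [ b ] tailY) ≡ 4)
  forces-four-bins hist rewrite eighth-opens (A hist 1/8) with quarter-placement (A (hist ++ [ 1/8 ]) 1/4)
  ... | inj₁ third-bin rewrite third-bin = inj₁ (finish-X _)
  ... | inj₂ joins     rewrite joins     = inj₂ (finish-Y _)

-- Offline packings described by labelling the items with bin numbers.

binOf : ∀ {m} → List ℚ → (ℕ → Fin m) → Fin m → List ℚ
binOf []       g j = []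
binOf (x ∷ xs) g j with g 0 Fin.≟ j
... | yes _ = x ∷ binOf xs (g ∘ suc) j
... | no _  = binOf xs (g ∘ suc) j

binOfTable : ∀ {m} n → (Fin n → ℚ) → (Fin n → Fin m) → Fin m → List ℚ
binOfTable zero    v f j = []
binOfTable (suc n) v f j with f Fin.zero Fin.≟ j
... | yes _ = v Fin.zero ∷ binOfTable n (v ∘ Fin.suc) (f ∘ Fin.suc) j
... | no _  = binOfTable n (v ∘ Fin.suc) (f ∘ Fin.suc) j

filter-tabulate : ∀ {m N} n (h : Fin n → Fin N) (v : Fin N → ℚ) (f : Fin N → Fin m) j →
  map v (filter (λ i → f i Fin.≟ j) (tabulate h)) ≡ binOfTable n (v ∘ h) (f ∘ h) j
filter-tabulate zero    h v f j = refl
filter-tabulate (suc n) h v f j with f (h Fin.zero) Fin.≟ j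
... | yes _ = cong (v (h Fin.zero) ∷_) (filter-tabulate n (h ∘ Fin.suc) v f j)
... | no _  = filter-tabulate n (h ∘ Fin.suc) v f j

binOfTable-lookup : ∀ {m} (xs : List ℚ) (g : ℕ → Fin m) j →
  binOfTable (length xs) (lookup xs) (g ∘ toℕ) j ≡ binOf xs g j
binOfTable-lookup []       g j = refl
binOfTable-lookup (x ∷ xs) g j with g 0 Fin.≟ j
... | yes _ = cong (x ∷_) (binOfTable-lookup xs (g ∘ suc) j)
... | no _  = binOfTable-lookup xs (g ∘ suc) j

binContents-labels : ∀ {m} (xs : List ℚ) (g : ℕ → Fin m) j → binContents xs (g ∘ toℕ) j ≡ binOf xs g j
binContents-labels xs g j =
  trans (filter-tabulate (length xs) (λ i → i) (lookup xs) (g ∘ toℕ) j) (binOfTable-lookup xs g j)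

FeasibleBin : ℕ → List ℚ → Set
FeasibleBin k b = (level b ℚ.≤ 1ℚ) × (length b ≤ k)

packing-by-labels : ∀ {k m} (xs : List ℚ) (g : ℕ → Fin m) →
  ((j : Fin m) → FeasibleBin k (binOf xs g j)) → Packing k xs m
packing-by-labels {k} xs g feasible =
  g ∘ toℕ , λ j → subst (FeasibleBin k) (sym (binContents-labels xs g j)) (feasible j)

-- Labelling by a list of labels (items beyond its end get label 0).
labelAt : ∀ {m} → List (Fin (suc m)) → ℕ → Fin (suc m)
labelAt []       _       = Fin.zero
labelAt (c ∷ cs) zero    = c
labelAt (c ∷ cs) (suc i) = labelAt cs i

binOf-const : ∀ {m} (xs : List ℚ) (j : Fin m) → binOf xs (λ _ → j) j ≡ xs
binOf-const []       j = refl
binOf-const (x ∷ xs) j with j Fin.≟ j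
... | yes _ = cong (x ∷_) (binOf-const xs j)
... | no j≢j = ⊥-elim (j≢j refl)

binOf-replicate-same : ∀ {m} n x tl (ls : List (Fin (suc m))) j →
  binOf (replicate n x ++ tl) (labelAt (replicate n j ++ ls)) j ≡ replicate n x ++ binOf tl (labelAt ls) j
binOf-replicate-same zero    x tl ls j = refl
binOf-replicate-same (suc n) x tl ls j with j Fin.≟ j
... | yes _  = cong (x ∷_) (binOf-replicate-same n x tl ls j)
... | no j≢j = ⊥-elim (j≢j refl)

binOf-replicate-other : ∀ {m} n x tl (ls : List (Fin (suc m))) c j → ¬ c ≡ j →
  binOf (replicate n x ++ tl) (labelAt (replicate n c ++ ls)) j ≡ binOf tl (labelAt ls) j
binOf-replicate-other zero    x tl ls c j c≢j = refl
binOf-replicate-other (suc n) x tl ls c j c≢j with c Fin.≟ j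
... | yes c≡j = ⊥-elim (c≢j c≡j)
... | no _    = binOf-replicate-other n x tl ls c j c≢j

-- The adversary.

Refutation : ℕ → OnlineAlg → ℚ → Set
Refutation k A c = Σ (List ℚ) λ L → All ValidSize L ×
  Σ ℕ λ m → Packing k L m × (c * ℕtoℚ m < ℕtoℚ (cost k A L))

twice-beats : ∀ c → c < + 2 / 1 → (m n : ℕ) → 0ℚ < ℕtoℚ m →
  + 2 / 1 * ℕtoℚ m ≡ ℕtoℚ n → c * ℕtoℚ m < ℕtoℚ n
twice-beats c c<2 m n m-pos doubled =
  subst (c * ℕtoℚ m <_) doubled (ℚP.*-monoˡ-<-pos (ℕtoℚ m) {{ℚ.positive m-pos}} c<2)

valid-size : ∀ q {pos : True (0ℚ ℚP.<? q)} {≤1 : True (q ℚP.≤? 1ℚ)} → ValidSize q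
valid-size q {pos} {≤1} = toWitness pos , toWitness ≤1

grain-bin : ∀ {k} k′ n tl → n ≤ suc k′ → True (1/24 + level tl ℚP.≤? 1ℚ) → n ℕ.+ length tl ≤ k →
  FeasibleBin k (replicate n (grain k′) ++ tl)
grain-bin k′ n tl n≤ room len≤ =
  ℚP.≤-trans (ℚP.≤-reflexive (level-++ (replicate n (grain k′)) tl))
    (ℚP.≤-trans (ℚP.+-monoˡ-≤ (level tl) (grains-level k′ n n≤)) (toWitness room)) ,
  subst (_≤ _) (sym length≡) len≤
  where
  length≡ : length (replicate n (grain k′) ++ tl) ≡ n ℕ.+ length tl
  length≡ = trans (LP.length-++ (replicate n (grain k′))) (cong (ℕ._+ length tl) (LP.length-replicate n))

module Adversary (k₂ : ℕ) (2≤k₂ : 2 ≤ k₂) (A : OnlineAlg) (c : ℚ) (c<2 : c < + 2 / 1) where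

  k : ℕ
  k = suc (suc k₂)

  u : ℚ
  u = grain (suc k₂)

  one : Fin 2
  one = Fin.suc Fin.zero

  stops-early : OpensSecondBin k A u k → Refutation k A c
  stops-early (j , j≤k , two) =
    replicate j u , replicate⁺ j (grain-valid (suc k₂)) , 1 , packing ,
    twice-beats c c<2 1 (cost k A (replicate j u)) (toWitness {a? = 0ℚ ℚP.<? ℕtoℚ 1} tt) (cong ℕtoℚ (sym two))
    where
    single-bin : FeasibleBin k (replicate j u)
    single-bin = subst (FeasibleBin k) (LP.++-identityʳ (replicate j u))
      (grain-bin (suc k₂) j [] j≤k tt (subst (_≤ k) (sym (ℕP.+-identityʳ j)) j≤k))
    packing : Packing k (replicate j u) 1
    packing = packing-by-labels (replicate j u) (λ _ → Fin.zero)
      λ { Fin.zero → subst (FeasibleBin k) (sym (binOf-const (replicate j u) Fin.zero)) single-bin ; (Fin.suc ()) }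

  small-bin : ∀ tl → length tl ≤ 2 → True (1/24 + level tl ℚP.≤? 1ℚ) → FeasibleBin k (u ∷ u ∷ tl)
  small-bin tl len≤2 room = grain-bin (suc k₂) 2 tl (s≤s (s≤s z≤n)) room (s≤s (s≤s (ℕP.≤-trans len≤2 2≤k₂)))

  large-bin : ∀ tl → length tl ≡ 2 → True (1/24 + level tl ℚP.≤? 1ℚ) → FeasibleBin k (replicate k₂ u ++ tl)
  large-bin tl len≡2 room = grain-bin (suc k₂) k₂ tl (ℕP.m≤n⇒m≤1+n (ℕP.n≤1+n k₂)) room
    (subst (λ l → k₂ ℕ.+ l ≤ k) (sym len≡2) (ℕP.≤-reflexive (ℕP.+-comm k₂ 2)))

  two-bin-packing : ∀ tl ls →
    FeasibleBin k (u ∷ u ∷ binOf tl (labelAt ls) Fin.zero) →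
    FeasibleBin k (replicate k₂ u ++ binOf tl (labelAt ls) one) →
    Packing k (replicate k u ++ tl) 2
  two-bin-packing tl ls bin₀ bin₁ = packing-by-labels (replicate k u ++ tl) labels
    λ { Fin.zero → subst (FeasibleBin k)
                     (sym (cong (λ b → u ∷ u ∷ b) (binOf-replicate-other k₂ u tl ls one Fin.zero (λ ())))) bin₀
      ; (Fin.suc Fin.zero) → subst (FeasibleBin k) (sym (binOf-replicate-same k₂ u tl ls one)) bin₁
      ; (Fin.suc (Fin.suc ())) }
    where
    labels : ℕ → Fin 2
    labels = labelAt (Fin.zero ∷ Fin.zero ∷ replicate k₂ one ++ ls)

  packing-X : Packing k (replicate k u ++ tailX) 2
  packing-X = two-bin-packing tailX (one ∷ one ∷ Fin.zero ∷ [])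
    (small-bin [ 11/12 ] (s≤s z≤n) tt) (large-bin (1/8 ∷ 1/4 ∷ []) refl tt)

  -- Offline: {u, u, 1/4, 2/3} (this needs k ≥ 4) and {k₂ grains, 1/8, 2/3}.
  packing-Y : Packing k (replicate k u ++ tailY) 2
  packing-Y = two-bin-packing tailY (one ∷ Fin.zero ∷ Fin.zero ∷ one ∷ [])
    (small-bin (1/4 ∷ 2/3 ∷ []) ℕP.≤-refl tt) (large-bin (1/8 ∷ 2/3 ∷ []) refl tt)

  grains-then : runFrom k A [] [] (replicate k u) ≡ [ replicate k u ] →
    ∀ tl → All ValidSize tl → Packing k (replicate k u ++ tl) 2 →
    length (runFrom k A (replicate k u) [ replicate k u ] tl) ≡ 4 → Refutation k A c
  grains-then one-bin tl valid packing four =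
    replicate k u ++ tl , ++⁺ (replicate⁺ k (grain-valid (suc k₂))) valid , 2 , packing ,
    twice-beats c c<2 2 (cost k A (replicate k u ++ tl)) (toWitness {a? = 0ℚ ℚP.<? ℕtoℚ 2} tt) (cong ℕtoℚ (sym cost≡4))
    where
    cost≡4 : cost k A (replicate k u ++ tl) ≡ 4
    cost≡4 = trans (cong length (trans (runFrom-++ k A [] [] (replicate k u) tl)
                                       (cong (λ bins → runFrom k A (replicate k u) bins tl) one-bin)))
                   four

  after-grains : runFrom k A [] [] (replicate k u) ≡ [ replicate k u ] → Refutation k A c
  after-grains one-bin =
    [ grains-then one-bin tailX (valid-size 1/8 ∷ valid-size 1/4 ∷ valid-size 11/12 ∷ []) packing-X
    , grains-then one-bin tailY (valid-size 1/8 ∷ valid-size 1/4 ∷ valid-size 2/3 ∷ valid-size 2/3 ∷ []) packing-Y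
    ]′ (AfterFullBin.forces-four-bins k A (replicate k u) (LP.length-replicate k) (replicate k u))

  refutation : Refutation k A c
  refutation = [ stops-early , after-grains ]′ (equal-items-phase k A u (suc k₂))

mainTheorem1 : (k : ℕ) → 4 ≤ k → (A : OnlineAlg) → (c : ℚ) → c < + 2 / 1 →
    Σ (List ℚ) λ L → All ValidSize L ×
      Σ ℕ λ m → Packing k L m × (c * ℕtoℚ m < ℕtoℚ (cost k A L))
mainTheorem1 (suc (suc k₂)) (s≤s (s≤s 2≤k₂)) A c c<2 = Adversary.refutation k₂ 2≤k₂ A c c<2
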